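{- Let $G=(V,E)$ be a connected finite simple graph, let $B\subseteq E$ be its set of bridges, and let $S\subseteq V$ be the set of isolated vertices of $G-B$. If $S=\emptyset$ and every two-edge connected component of $G-B$ is all-round, then $G$ is all-round.
   Context: A bridge is an edge whose removal disconnects the graph. For a graph $H=(V,E)$ and $f\colon V\to\{0,1,2,3\}$, a connected mod-4 $f$-factor is a vector $\mathbf{x}\in\{0,1,2,3\}^E$ with $\sum_{e\in\delta(v)}x_e\equiv f(v)\pmod 4$ for all $v\in V$ ($\delta(v)$ = edges incident to $v$) such that the graph $(V,\{e\in E\mid x_e>0\})$ is connected. $H$ is all-round if it has a connected mod-4 $f$-factor for every $f\colon V\to\{0,1,2,3\}$ with $\sum_{v\in V}f(v)$ even. -}

module Defs where

open import Data.Nat using (ℕ; _%_)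
open import Data.Nat.Divisibility using (_∣_)
open import Data.Fin using (Fin; zero; toℕ; _≟_)
open import Data.List using (List; map; allFin)
open import Data.Nat.ListAction using (sum)
open import Data.Bool using (Bool; true; false; if_then_else_; _∨_)
open import Data.Product using (Σ; ∃; _×_)
open import Data.Sum using (_⊎_)
open import Data.Unit using (⊤)
open import Relation.Nullary using (¬_; does)
open import Relation.Binary.PropositionalEquality using (_≡_; _≢_)

record Graph : Set where
  field
    n   : ℕ
    m   : ℕ
    src : Fin m → Fin n
    tgt : Fin m → Fin n
    loopless : ∀ e → src e ≢ tgt e
    simple : ∀ e e′ → ((src e ≡ src e′ × tgt e ≡ tgt e′) ⊎ (src e ≡ tgt e′ × tgt e ≡ src e′)) → e ≡ e′

module _ (G : Graph) where
  open Graph G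

  Joins : Fin m → Fin n → Fin n → Set
  Joins e u w = (src e ≡ u × tgt e ≡ w) ⊎ (src e ≡ w × tgt e ≡ u)

  data Reach (Q : Fin m → Set) : Fin n → Fin n → Set where
    here : ∀ {u} → Reach Q u u
    step : ∀ {u w v} (e : Fin m) → Q e → Joins e u w → Reach Q w v → Reach Q u v

  -- the graph with vertex set C and edge set Q is connected
  -- (used only when every edge in Q has both endpoints in C)
  ConnectedOn : (Fin n → Bool) → (Fin m → Set) → Set
  ConnectedOn C Q = ∀ u v → C u ≡ true → C v ≡ true → Reach Q u v

  Connected : Set
  Connected = ConnectedOn (λ _ → true) (λ _ → ⊤)

  Bridge : Fin m → Set
  Bridge e = ¬ ConnectedOn (λ _ → true) (λ e′ → e′ ≢ e)

  sumFin : ∀ k → (Fin k → ℕ) → ℕ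
  sumFin k h = sum (map h (allFin k))

  degSum : (Fin m → Fin 4) → Fin n → ℕ
  degSum x v = sumFin m (λ e → if does (src e ≟ v) ∨ does (tgt e ≟ v) then toℕ (x e) else 0)

  -- The subgraph H = (C, D) is all-round: for every f : C → {0,1,2,3} with
  -- even sum there is a connected mod-4 f-factor x ∈ {0,1,2,3}^D
  -- (x is extended by 0 outside D; f is only read on C).
  AllRoundOn : (Fin n → Bool) → (Fin m → Set) → Set
  AllRoundOn C D =
    (f : Fin n → Fin 4) →
    2 ∣ sumFin n (λ v → if C v then toℕ (f v) else 0) →
    Σ (Fin m → Fin 4) λ x →
      (∀ e → ¬ D e → x e ≡ zero) ×
      (∀ v → C v ≡ true → degSum x v % 4 ≡ toℕ (f v)) ×
      ConnectedOn C (λ e → D e × x e ≢ zero)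

  AllRound : Set
  AllRound = AllRoundOn (λ _ → true) (λ _ → ⊤)

  CompEdges : (Fin n → Bool) → Fin m → Set
  CompEdges C e = ¬ Bridge e × C (src e) ≡ true × C (tgt e) ≡ true

  -- C is (the vertex set of) a connected component of G - B,
  -- i.e. a two-edge connected component of G - B
  IsComponentOfG-B : (Fin n → Bool) → Set
  IsComponentOfG-B C =
    (∃ λ v → C v ≡ true) ×
    ConnectedOn C (CompEdges C) ×
    (∀ e → ¬ Bridge e → (C (src e) ≡ true → C (tgt e) ≡ true) × (C (tgt e) ≡ true → C (src e) ≡ true))

  IsolatedInG-B : Fin n → Set
  IsolatedInG-B v = ∀ e → ¬ Bridge e → ¬ (src e ≡ v ⊎ tgt e ≡ v)

-- Give every bridge e a value in {1, 2} and ask each component H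
-- of G - B for a connected mod-4 factor of f minus the bridge contributions; H can provide it
-- as soon as that demand has even sum on H, i.e. as soon as the number of bridges leaving H
-- with odd value has the parity of the sum of f over H. These parities come from a T-join for
-- T = {v | f v odd}: sum, mod 2, walks from a fixed root to the vertices of T. A walk crosses
-- the boundary of a vertex set C an odd number of times iff exactly one of its ends lies in C,
-- and only bridges cross the boundary of a component; as the total sum of f is even, the
-- crossing parity at H is the parity of f on H. Gluing the factors of the components with
-- the (nonzero) bridge values gives a mod-4 f-factor whose support contains all bridges and
-- connects every component, so it is connected.

module Submission where

open import Defs
open import Algebra.Bundles using (Semiring)
import Algebra.Properties.Semiring.Sum
open import Data.Bool using (Bool; true; false; if_then_else_; _∨_)
open import Data.Fin using (Fin; zero; suc; toℕ; _≟_; _<_)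
open import Data.Fin.Properties using (<-cmp; all?; toℕ<n; toℕ-fromℕ<)
open import Data.List using (List; []; _∷_; allFin; tabulate)
open import Data.List.Membership.Propositional using (_∈_)
open import Data.List.Membership.Propositional.Properties using (∈-allFin)
open import Data.List.Properties using (map-tabulate)
open import Data.List.Relation.Unary.Any using (here; there)
import Data.Nat as ℕ
open import Data.Nat using (ℕ; _%_; parity)
open import Data.Nat.DivMod using (_mod_; %-distribˡ-+; [m+kn]%n≡m%n; m≡m%n+[m/n]*n; m<n⇒m%n≡m; m%n<n)
open import Data.Nat.Divisibility using (_∣_; divides; _∣0; ∣m∣n⇒∣m+n; ∣-refl)
import Data.Nat.ListAction as List
import Data.Nat.Properties as ℕₚ
open import Data.Nat.Tactic.RingSolver using (solve-∀)
open import Data.Parity.Base using (Parity; 0ℙ; 1ℙ)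
open import Data.Parity.Properties
  using (+-assoc; +-comm; +-identityʳ; *-comm; *-assoc; *-zeroʳ; *-distribʳ-+; *-distribˡ-+; p+p≡0ℙ; +-homo-+; *-homo-*; +-*-semiring)
open import Data.Product using (Σ; ∃; _×_; _,_; proj₁; proj₂)
open import Data.Sum using (_⊎_; inj₁; inj₂)
open import Data.Unit using (⊤; tt)
open import Function using (_∘_; id)
open import Function.Bundles using (mk⇔)
open import Level using (0ℓ)
open import Relation.Binary.Definitions using (tri<; tri≈; tri>)
open import Relation.Binary.PropositionalEquality
open import Relation.Nullary using (¬_; Dec; yes; no; does; proof; ¬?; contradiction)
open import Relation.Nullary.Decidable using (map′; _×-dec_; _⊎-dec_; dec-true; dec-false; does-⇔)
open import Relation.Nullary.Reflects using (Reflects; invert)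
open import Relation.Unary using (Pred; Decidable)

module ℕ∑ = Algebra.Properties.Semiring.Sum ℕₚ.+-*-semiring
open Algebra.Properties.Semiring.Sum +-*-semiring
-- Data.Parity.Base gives _+_ and _*_ the same precedence; the semiring's fixities are the usual ones.
open Semiring +-*-semiring using (_+_; _*_)

-- Sums and parities

sum-tabulate : ∀ {k} (h : Fin k → ℕ) → List.sum (tabulate h) ≡ ℕ∑.sum h
sum-tabulate {ℕ.zero} h = refl
sum-tabulate {ℕ.suc k} h = cong (h zero ℕ.+_) (sum-tabulate (h ∘ suc))

sumFin≡∑ : ∀ G k (h : Fin k → ℕ) → sumFin G k h ≡ ℕ∑.sum h
sumFin≡∑ G k h = trans (cong List.sum (map-tabulate id h)) (sum-tabulate h)

parity-∑ : ∀ {k} (h : Fin k → ℕ) → parity (ℕ∑.sum h) ≡ ∑[ i < k ] parity (h i)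
parity-∑ {ℕ.zero} h = refl
parity-∑ {ℕ.suc k} h = trans (+-homo-+ (h zero) _) (cong (parity (h zero) +_) (parity-∑ (h ∘ suc)))

parity-sumFin : ∀ G k (h : Fin k → ℕ) → parity (sumFin G k h) ≡ ∑[ i < k ] parity (h i)
parity-sumFin G k h = trans (cong parity (sumFin≡∑ G k h)) (parity-∑ h)

∣⇒parity≡0ℙ : ∀ {k} → 2 ∣ k → parity k ≡ 0ℙ
∣⇒parity≡0ℙ (divides q refl) = trans (*-homo-* q 2) (*-zeroʳ (parity q))

parity≡0ℙ⇒∣ : ∀ {k} → parity k ≡ 0ℙ → 2 ∣ k
parity≡0ℙ⇒∣ {ℕ.zero} _ = 2 ∣0
parity≡0ℙ⇒∣ {ℕ.suc (ℕ.suc k)} p = ∣m∣n⇒∣m+n (∣-refl {2}) (parity≡0ℙ⇒∣ p)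

parity-mod4 : ∀ k → parity (toℕ (k mod 4)) ≡ parity k
parity-mod4 k = sym (begin
  parity k                                      ≡⟨ cong parity (m≡m%n+[m/n]*n k 4) ⟩
  parity (k % 4 ℕ.+ k ℕ./ 4 ℕ.* 4)                 ≡⟨ +-homo-+ (k % 4) _ ⟩
  parity (k % 4) + parity (k ℕ./ 4 ℕ.* 4)         ≡⟨ cong (parity (k % 4) +_) (trans (*-homo-* (k ℕ./ 4) 4) (*-zeroʳ _)) ⟩
  parity (k % 4) + 0ℙ                             ≡⟨ +-identityʳ (parity (k % 4)) ⟩
  parity (k % 4)                                  ≡⟨ cong parity (sym (toℕ-fromℕ< (m%n<n k 4))) ⟩
  parity (toℕ (k mod 4))                          ∎)
  where open ≡-Reasoning

%4-subtract : ∀ d a b → d % 4 ≡ (a ℕ.+ 3 ℕ.* b) % 4 → (d ℕ.+ b) % 4 ≡ a % 4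
%4-subtract d a b d≡a-b = begin
  (d ℕ.+ b) % 4                           ≡⟨ %-distribˡ-+ d b 4 ⟩
  (d % 4 ℕ.+ b % 4) % 4                   ≡⟨ cong (λ k → (k ℕ.+ b % 4) % 4) d≡a-b ⟩
  ((a ℕ.+ 3 ℕ.* b) % 4 ℕ.+ b % 4) % 4     ≡⟨ sym (%-distribˡ-+ (a ℕ.+ 3 ℕ.* b) b 4) ⟩
  (a ℕ.+ 3 ℕ.* b ℕ.+ b) % 4               ≡⟨ cong (_% 4) (rearrange a b) ⟩
  (a ℕ.+ b ℕ.* 4) % 4                     ≡⟨ [m+kn]%n≡m%n a b 4 ⟩
  a % 4                                   ∎
  where
  open ≡-Reasoning
  rearrange : ∀ a b → a ℕ.+ 3 ℕ.* b ℕ.+ b ≡ a ℕ.+ b ℕ.* 4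
  rearrange = solve-∀

ℙ[_] : Bool → Parity
ℙ[ true ] = 1ℙ
ℙ[ false ] = 0ℙ

parity-if : ∀ b k → parity (if b then k else 0) ≡ ℙ[ b ] * parity k
parity-if true k = refl
parity-if false k = refl

∑-δ : ∀ {k} (i : Fin k) (h : Fin k → Parity) → ∑[ j < k ] (ℙ[ does (i ≟ j) ] * h j) ≡ h i
∑-δ {ℕ.suc k} zero h = trans (cong (h zero +_) (sum-replicate-zero k)) (+-identityʳ (h zero))
∑-δ (suc i) h = ∑-δ i (h ∘ suc)

-- Least elements of decidable subsets of Fin k

Least : ∀ {k} → Pred (Fin k) 0ℓ → Fin k → Set
Least P i = P i × (∀ {j} → j < i → ¬ P j)

Least-unique : ∀ {k} {P : Pred (Fin k) 0ℓ} {i j} → Least P i → Least P j → i ≡ j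
Least-unique {i = i} {j} (pi , min-i) (pj , min-j) with <-cmp i j
... | tri< i<j _ _ = contradiction pi (min-j i<j)
... | tri≈ _ i≡j _ = i≡j
... | tri> _ _ j<i = contradiction pj (min-i j<i)

least : ∀ {k} {P : Pred (Fin k) 0ℓ} {i} → Decidable P → P i → ∃ (Least P)
least {i = zero} P? p = zero , p , λ ()
least {i = suc i} P? p with P? zero
... | yes p₀ = zero , p₀ , λ ()
... | no ¬p₀ with least (P? ∘ suc) p
...   | j , pj , min = suc j , pj , λ { {zero} _ → ¬p₀ ; {suc l} (ℕ.s≤s l<j) → min l<j }

-- Walks

module _ (G : Graph) where
  open Graph G

  private variable
    Q Q′ : Fin m → Set
    e e′ : Fin m
    u v w : Fin n

  Joins-sym : Joins G e u w → Joins G e w u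
  Joins-sym (inj₁ (s , t)) = inj₂ (s , t)
  Joins-sym (inj₂ (s , t)) = inj₁ (s , t)

  Reach-trans : Reach G Q u v → Reach G Q v w → Reach G Q u w
  Reach-trans here r = r
  Reach-trans (step e q j r) r′ = step e q j (Reach-trans r r′)

  Reach-sym : Reach G Q u v → Reach G Q v u
  Reach-sym here = here
  Reach-sym (step e q j r) = Reach-trans (Reach-sym r) (step e q (Joins-sym j) here)

  Reach-refine : (∀ {e a b} → Q e → Joins G e a b → Reach G Q′ a b) → Reach G Q u v → Reach G Q′ u v
  Reach-refine edge here = here
  Reach-refine edge (step e q j r) = Reach-trans (edge q j) (Reach-refine edge r)

  Reach-map : (∀ {e} → Q e → Q′ e) → Reach G Q u v → Reach G Q′ u v
  Reach-map g = Reach-refine λ q j → step _ (g q) j here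

  Via : (Fin n → Fin n → Set) → Fin m → Fin n → Fin n → Set
  Via R e u v = R u v ⊎ (R u (src e) × R (tgt e) v) ⊎ (R u (tgt e) × R (src e) v)

  module _ {Q : Fin m → Set} (Q? : Decidable Q) where

    Listed : List (Fin m) → Fin m → Set
    Listed es e = e ∈ es × Q e

    private
      Via-prepend-walk : ∀ {es} → Reach G (Listed es) u w → Via (Reach G (Listed es)) e w v → Via (Reach G (Listed es)) e u v
      Via-prepend-walk r (inj₁ r′) = inj₁ (Reach-trans r r′)
      Via-prepend-walk r (inj₂ (inj₁ (r₁ , r₂))) = inj₂ (inj₁ (Reach-trans r r₁ , r₂))
      Via-prepend-walk r (inj₂ (inj₂ (r₁ , r₂))) = inj₂ (inj₂ (Reach-trans r r₁ , r₂))

      Via-prepend-edge : ∀ {es} → Joins G e u w → Via (Reach G (Listed es)) e w v → Via (Reach G (Listed es)) e u v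
      Via-prepend-edge (inj₁ (refl , refl)) (inj₁ r) = inj₂ (inj₁ (here , r))
      Via-prepend-edge (inj₁ (refl , refl)) (inj₂ (inj₁ (r₁ , r₂))) = inj₁ (Reach-trans (Reach-sym r₁) r₂)
      Via-prepend-edge (inj₁ (refl , refl)) (inj₂ (inj₂ (_ , r₂))) = inj₁ r₂
      Via-prepend-edge (inj₂ (refl , refl)) (inj₁ r) = inj₂ (inj₂ (here , r))
      Via-prepend-edge (inj₂ (refl , refl)) (inj₂ (inj₁ (_ , r₂))) = inj₁ r₂
      Via-prepend-edge (inj₂ (refl , refl)) (inj₂ (inj₂ (r₁ , r₂))) = inj₁ (Reach-trans (Reach-sym r₁) r₂)

      Reach⇒Via : ∀ {es} → Reach G (Listed (e ∷ es)) u v → Via (Reach G (Listed es)) e u v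
      Reach⇒Via here = inj₁ here
      Reach⇒Via (step _ (here refl , _) j r) = Via-prepend-edge j (Reach⇒Via r)
      Reach⇒Via (step e′ (there p , q) j r) = Via-prepend-walk (step e′ (p , q) j here) (Reach⇒Via r)

      Via⇒Reach : ∀ {es} → Q e → Via (Reach G (Listed es)) e u v → Reach G (Listed (e ∷ es)) u v
      Via⇒Reach q (inj₁ r) = Reach-map (λ (p , q′) → there p , q′) r
      Via⇒Reach {e} q (inj₂ (inj₁ (r₁ , r₂))) =
        Reach-trans (Via⇒Reach q (inj₁ r₁)) (step e (here refl , q) (inj₁ (refl , refl)) (Via⇒Reach q (inj₁ r₂)))
      Via⇒Reach {e} q (inj₂ (inj₂ (r₁ , r₂))) =
        Reach-trans (Via⇒Reach q (inj₁ r₁)) (step e (here refl , q) (inj₂ (refl , refl)) (Via⇒Reach q (inj₁ r₂)))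

      Listed-drop : ∀ {es} → ¬ Q e → Listed (e ∷ es) e′ → Listed es e′
      Listed-drop ¬q (here refl , q) = contradiction q ¬q
      Listed-drop ¬q (there p , q) = p , q

    -- Edges are added one at a time; a new edge e can only merge the classes of src e and tgt e.
    reachListed? : ∀ es u v → Dec (Reach G (Listed es) u v)
    reachListed? [] u v = map′ (λ { refl → here }) (λ { here → refl ; (step _ (() , _) _ _) }) (u ≟ v)
    reachListed? (e ∷ es) u v with Q? e
    ... | no ¬q = map′ (Reach-map (λ (p , q) → there p , q)) (Reach-map (Listed-drop ¬q)) (reachListed? es u v)
    ... | yes q = map′ (Via⇒Reach q) Reach⇒Via (R? u v ⊎-dec (R? u (src e) ×-dec R? (tgt e) v) ⊎-dec (R? u (tgt e) ×-dec R? (src e) v))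
      where R? = reachListed? es

    reach? : ∀ u v → Dec (Reach G Q u v)
    reach? u v = map′ (Reach-map proj₂) (Reach-map (λ q → ∈-allFin _ , q)) (reachListed? (allFin m) u v)

-- Cuts

module _ (G : Graph) where
  open Graph G

  private variable
    Q : Fin m → Set
    a b : Fin n

  cut : (Fin n → Bool) → Fin m → Parity
  cut C e = ℙ[ C (src e) ] + ℙ[ C (tgt e) ]

  crossings : Reach G Q a b → Fin m → Parity
  crossings here _ = 0ℙ
  crossings (step e′ _ _ r) e = ℙ[ does (e′ ≟ e) ] + crossings r e

  cut-Joins : ∀ C {e} → Joins G e a b → cut C e ≡ ℙ[ C a ] + ℙ[ C b ]
  cut-Joins C (inj₁ (refl , refl)) = refl
  cut-Joins C {e} (inj₂ (refl , refl)) = +-comm ℙ[ C (src e) ] ℙ[ C (tgt e) ]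

  ∑-crossings-cut : ∀ C (r : Reach G Q a b) → ∑[ e < m ] (crossings r e * cut C e) ≡ ℙ[ C a ] + ℙ[ C b ]
  ∑-crossings-cut {a = a} C here = trans (sum-replicate-zero m) (sym (p+p≡0ℙ ℙ[ C a ]))
  ∑-crossings-cut {a = a} {b} C (step {w = w} e′ _ j r) = begin
    ∑[ e < m ] ((ℙ[ does (e′ ≟ e) ] + crossings r e) * cut C e)
      ≡⟨ sum-cong-≗ {m} (λ e → *-distribʳ-+ (cut C e) ℙ[ does (e′ ≟ e) ] (crossings r e)) ⟩
    ∑[ e < m ] (ℙ[ does (e′ ≟ e) ] * cut C e + crossings r e * cut C e)
      ≡⟨ ∑-distrib-+ (λ e → ℙ[ does (e′ ≟ e) ] * cut C e) (λ e → crossings r e * cut C e) ⟩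
    ∑[ e < m ] (ℙ[ does (e′ ≟ e) ] * cut C e) + ∑[ e < m ] (crossings r e * cut C e)
      ≡⟨ cong₂ _+_ (trans (∑-δ e′ (cut C)) (cut-Joins C j)) (∑-crossings-cut C r) ⟩
    (ℙ[ C a ] + ℙ[ C w ]) + (ℙ[ C w ] + ℙ[ C b ])
      ≡⟨ +-assoc ℙ[ C a ] _ _ ⟩
    ℙ[ C a ] + (ℙ[ C w ] + (ℙ[ C w ] + ℙ[ C b ]))
      ≡⟨ cong (ℙ[ C a ] +_) (trans (sym (+-assoc ℙ[ C w ] _ _)) (cong (_+ ℙ[ C b ]) (p+p≡0ℙ ℙ[ C w ]))) ⟩
    ℙ[ C a ] + ℙ[ C b ]
      ∎
    where open ≡-Reasoning

  incident : Fin m → Fin n → Bool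
  incident e v = does (src e ≟ v) ∨ does (tgt e ≟ v)

  degSum-split : ∀ (x x₁ x₂ : Fin m → Fin 4) v →
    (∀ e → incident e v ≡ true → toℕ (x e) ≡ toℕ (x₁ e) ℕ.+ toℕ (x₂ e)) →
    degSum G x v ≡ degSum G x₁ v ℕ.+ degSum G x₂ v
  degSum-split x x₁ x₂ v split = begin
    degSum G x v                              ≡⟨ sumFin≡∑ G m _ ⟩
    ℕ∑.sum (λ e → at e (toℕ (x e)))              ≡⟨ ℕ∑.sum-cong-≗ {m} pointwise ⟩
    ℕ∑.sum (λ e → at e (toℕ (x₁ e)) ℕ.+ at e (toℕ (x₂ e)))
                                              ≡⟨ ℕ∑.∑-distrib-+ (λ e → at e (toℕ (x₁ e))) (λ e → at e (toℕ (x₂ e))) ⟩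
    ℕ∑.sum (λ e → at e (toℕ (x₁ e))) ℕ.+ ℕ∑.sum (λ e → at e (toℕ (x₂ e)))
                                              ≡⟨ sym (cong₂ ℕ._+_ (sumFin≡∑ G m _) (sumFin≡∑ G m _)) ⟩
    degSum G x₁ v ℕ.+ degSum G x₂ v           ∎
    where
    open ≡-Reasoning
    at : Fin m → ℕ → ℕ
    at e k = if incident e v then k else 0
    pointwise : ∀ e → at e (toℕ (x e)) ≡ at e (toℕ (x₁ e)) ℕ.+ at e (toℕ (x₂ e))
    pointwise e with incident e v in inc
    ... | true = split e inc
    ... | false = refl

  ℙ-incident : ∀ e v → ℙ[ incident e v ] ≡ ℙ[ does (src e ≟ v) ] + ℙ[ does (tgt e ≟ v) ]
  ℙ-incident e v with src e ≟ v | tgt e ≟ v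
  ... | yes s | yes t = contradiction (trans s (sym t)) (loopless e)
  ... | yes _ | no _ = refl
  ... | no _ | yes _ = refl
  ... | no _ | no _ = refl

  ∑-incident : ∀ e (h : Fin n → Parity) → ∑[ v < n ] (ℙ[ incident e v ] * h v) ≡ h (src e) + h (tgt e)
  ∑-incident e h = begin
    ∑[ v < n ] (ℙ[ incident e v ] * h v)
      ≡⟨ sum-cong-≗ {n} (λ v → trans (cong (_* h v) (ℙ-incident e v)) (*-distribʳ-+ (h v) ℙ[ does (src e ≟ v) ] ℙ[ does (tgt e ≟ v) ])) ⟩
    ∑[ v < n ] (ℙ[ does (src e ≟ v) ] * h v + ℙ[ does (tgt e ≟ v) ] * h v)
      ≡⟨ ∑-distrib-+ (λ v → ℙ[ does (src e ≟ v) ] * h v) (λ v → ℙ[ does (tgt e ≟ v) ] * h v) ⟩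
    ∑[ v < n ] (ℙ[ does (src e ≟ v) ] * h v) + ∑[ v < n ] (ℙ[ does (tgt e ≟ v) ] * h v)
      ≡⟨ cong₂ _+_ (∑-δ (src e) h) (∑-δ (tgt e) h) ⟩
    h (src e) + h (tgt e)
      ∎
    where open ≡-Reasoning

  ∑-parity-degSum : ∀ C (z : Fin m → Fin 4) →
    ∑[ v < n ] (ℙ[ C v ] * parity (degSum G z v)) ≡ ∑[ e < m ] (parity (toℕ (z e)) * cut C e)
  ∑-parity-degSum C z = begin
    ∑[ v < n ] (ℙ[ C v ] * parity (degSum G z v))
      ≡⟨ sum-cong-≗ {n} (λ v → cong (ℙ[ C v ] *_) (parity-degSum v)) ⟩
    ∑[ v < n ] (ℙ[ C v ] * ∑[ e < m ] (ℙ[ incident e v ] * p e))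
      ≡⟨ sum-cong-≗ {n} (λ v → *-distribˡ-sum ℙ[ C v ] (λ e → ℙ[ incident e v ] * p e)) ⟩
    ∑[ v < n ] ∑[ e < m ] (ℙ[ C v ] * (ℙ[ incident e v ] * p e))
      ≡⟨ ∑-comm (λ v e → ℙ[ C v ] * (ℙ[ incident e v ] * p e)) ⟩
    ∑[ e < m ] ∑[ v < n ] (ℙ[ C v ] * (ℙ[ incident e v ] * p e))
      ≡⟨ sum-cong-≗ {m} (λ e → trans (sum-cong-≗ {n} (λ v → rearrange ℙ[ C v ] ℙ[ incident e v ] (p e)))
                                       (sym (*-distribˡ-sum (p e) (λ v → ℙ[ incident e v ] * ℙ[ C v ])))) ⟩
    ∑[ e < m ] (p e * ∑[ v < n ] (ℙ[ incident e v ] * ℙ[ C v ]))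
      ≡⟨ sum-cong-≗ {m} (λ e → cong (p e *_) (∑-incident e (λ v → ℙ[ C v ]))) ⟩
    ∑[ e < m ] (p e * cut C e)
      ∎
    where
    open ≡-Reasoning
    p : Fin m → Parity
    p e = parity (toℕ (z e))
    parity-degSum : ∀ v → parity (degSum G z v) ≡ ∑[ e < m ] (ℙ[ incident e v ] * p e)
    parity-degSum v = trans (parity-sumFin G m _) (sum-cong-≗ {m} (λ e → parity-if (incident e v) (toℕ (z e))))
    rearrange : ∀ c i q → c * (i * q) ≡ q * (i * c)
    rearrange c i q = trans (sym (*-assoc c i q)) (trans (*-comm (c * i) q) (cong (q *_) (*-comm c i)))

  module _ (connected : Connected G) (root : Fin n) where

    tJoin : (Fin n → Parity) → Fin m → Parity
    tJoin t e = ∑[ v < n ] (t v * crossings (connected root v refl refl) e)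

    ∑-tJoin-cut : ∀ t → ∑[ v < n ] t v ≡ 0ℙ → ∀ C →
      ∑[ e < m ] (tJoin t e * cut C e) ≡ ∑[ v < n ] (ℙ[ C v ] * t v)
    ∑-tJoin-cut t ∑t≡0 C = begin
      ∑[ e < m ] (tJoin t e * cut C e)
        ≡⟨ sum-cong-≗ {m} (λ e → *-distribʳ-sum (cut C e) (λ v → t v * κ v e)) ⟩
      ∑[ e < m ] ∑[ v < n ] (t v * κ v e * cut C e)
        ≡⟨ ∑-comm (λ e v → t v * κ v e * cut C e) ⟩
      ∑[ v < n ] ∑[ e < m ] (t v * κ v e * cut C e)
        ≡⟨ sum-cong-≗ {n} (λ v → trans (sum-cong-≗ {m} (λ e → *-assoc (t v) (κ v e) (cut C e)))
                                        (sym (*-distribˡ-sum (t v) (λ e → κ v e * cut C e)))) ⟩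
      ∑[ v < n ] (t v * ∑[ e < m ] (κ v e * cut C e))
        ≡⟨ sum-cong-≗ {n} (λ v → cong (t v *_) (∑-crossings-cut C (connected root v refl refl))) ⟩
      ∑[ v < n ] (t v * (ℙ[ C root ] + ℙ[ C v ]))
        ≡⟨ sum-cong-≗ {n} (λ v → trans (*-distribˡ-+ (t v) ℙ[ C root ] ℙ[ C v ])
                                        (cong₂ _+_ (*-comm (t v) ℙ[ C root ]) (*-comm (t v) ℙ[ C v ]))) ⟩
      ∑[ v < n ] (ℙ[ C root ] * t v + ℙ[ C v ] * t v)
        ≡⟨ ∑-distrib-+ (λ v → ℙ[ C root ] * t v) (λ v → ℙ[ C v ] * t v) ⟩
      ∑[ v < n ] (ℙ[ C root ] * t v) + ∑[ v < n ] (ℙ[ C v ] * t v)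
        ≡⟨ cong (_+ ∑[ v < n ] (ℙ[ C v ] * t v))
             (trans (sym (*-distribˡ-sum ℙ[ C root ] t)) (trans (cong (ℙ[ C root ] *_) ∑t≡0) (*-zeroʳ ℙ[ C root ]))) ⟩
      ∑[ v < n ] (ℙ[ C v ] * t v)
        ∎
      where
      open ≡-Reasoning
      κ : Fin n → Fin m → Parity
      κ v = crossings (connected root v refl refl)

-- The components of G - B

module Components (G : Graph) where
  open Graph G

  private variable
    e : Fin m
    r u v w : Fin n

  bridge? : Decidable (Bridge G)
  bridge? e = ¬? (map′ (λ c u v _ _ → c u v) (λ c u v → c u v refl refl)
                      (all? λ u → all? λ v → reach? G (λ e′ → ¬? (e′ ≟ e)) u v))

  _~_ : Fin n → Fin n → Set
  u ~ v = Reach G (λ e → ¬ Bridge G e) u v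

  _~?_ : ∀ u v → Dec (u ~ v)
  _~?_ = reach? G (¬? ∘ bridge?)

  ~-step : ¬ Bridge G e → Joins G e u w → r ~ u → r ~ w
  ~-step {e = e} nb j p = Reach-trans G p (step e nb j here)

  component : Fin n → Fin n → Bool
  component r v = does (r ~? v)

  ~⇒component : r ~ v → component r v ≡ true
  ~⇒component {r} {v} = dec-true (r ~? v)

  component⇒~ : component r v ≡ true → r ~ v
  component⇒~ {r} {v} c = invert (subst (Reflects (r ~ v)) c (proof (r ~? v)))

  component-step : ¬ Bridge G e → Joins G e u w → component r u ≡ true → component r w ≡ true
  component-step nb j = ~⇒component ∘ ~-step nb j ∘ component⇒~

  walk-in-component : component r u ≡ true → u ~ v → Reach G (CompEdges G (component r)) u v
  walk-in-component cu here = here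
  walk-in-component {r} cu (step {w = w} e nb j p) = step e (nb , endpoints j cu cw) j (walk-in-component cw p)
    where
    cw : component r w ≡ true
    cw = component-step nb j cu
    endpoints : ∀ {e u w} → Joins G e u w → component r u ≡ true → component r w ≡ true →
                component r (src e) ≡ true × component r (tgt e) ≡ true
    endpoints (inj₁ (refl , refl)) cu cw = cu , cw
    endpoints (inj₂ (refl , refl)) cu cw = cw , cu

  component-isComponent : ∀ r → IsComponentOfG-B G (component r)
  component-isComponent r =
    (r , ~⇒component here) ,
    (λ u v cu cv → walk-in-component cu (Reach-trans G (Reach-sym G (component⇒~ cu)) (component⇒~ cv))) ,
    (λ e nb → component-step nb (inj₁ (refl , refl)) , component-step nb (inj₂ (refl , refl)))

  cut-nonbridge : ∀ r {e} → ¬ Bridge G e → cut G (component r) e ≡ 0ℙ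
  cut-nonbridge r {e} nb = trans (cong (λ b → ℙ[ b ] + ℙ[ component r (tgt e) ]) same-side) (p+p≡0ℙ ℙ[ component r (tgt e) ])
    where
    same-side : component r (src e) ≡ component r (tgt e)
    same-side = does-⇔ (mk⇔ (~-step nb (inj₁ (refl , refl))) (~-step nb (inj₂ (refl , refl)))) (r ~? src e) (r ~? tgt e)

  representative : Fin n → Fin n
  representative v = proj₁ (least (v ~?_) here)

  ~-representative : ∀ v → v ~ representative v
  ~-representative v = proj₁ (proj₂ (least (v ~?_) here))

  representative-cong : u ~ v → representative u ≡ representative v
  representative-cong {u} {v} u~v = Least-unique (proj₂ (least (u ~?_) here)) least-from-u
    where
    least-from-u : Least (u ~_) (representative v)
    least-from-u = let (v~ρ , minimal) = proj₂ (least (v ~?_) here) in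
      Reach-trans G u~v v~ρ , λ j<ρ u~j → minimal j<ρ (Reach-trans G (Reach-sym G u~v) u~j)

-- Gluing the factors of the components along the bridges

module Gluing (G : Graph) (connected : Connected G)
  (components-allRound : ∀ C → IsComponentOfG-B G C → AllRoundOn G C (CompEdges G C))
  (f : Fin (Graph.n G) → Fin 4) (f-even : ∑[ v < Graph.n G ] parity (toℕ (f v)) ≡ 0ℙ)
  (root : Fin (Graph.n G)) where
  open Graph G
  open Components G

  private variable
    e : Fin m
    a b c : Fin n

  oddJoin : Fin m → Parity
  oddJoin = tJoin G connected root (λ v → parity (toℕ (f v)))

  nonzero : Parity → Fin 4
  nonzero 0ℙ = suc (suc zero)
  nonzero 1ℙ = suc zero

  parity-nonzero : ∀ p → parity (toℕ (nonzero p)) ≡ p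
  parity-nonzero 0ℙ = refl
  parity-nonzero 1ℙ = refl

  nonzero≢zero : ∀ p → nonzero p ≢ zero
  nonzero≢zero 0ℙ ()
  nonzero≢zero 1ℙ ()

  bridgeValue : Fin m → Fin 4
  bridgeValue e = if does (bridge? e) then nonzero (oddJoin e) else zero

  -- As 3 ≡ -1 (mod 4), f′ is f minus what the bridges contribute.
  f′ : Fin n → Fin 4
  f′ v = (toℕ (f v) ℕ.+ 3 ℕ.* degSum G bridgeValue v) mod 4

  parity-f′ : ∀ v → parity (toℕ (f′ v)) ≡ parity (toℕ (f v)) + parity (degSum G bridgeValue v)
  parity-f′ v = begin
    parity (toℕ (f′ v))                            ≡⟨ parity-mod4 (toℕ (f v) ℕ.+ 3 ℕ.* B) ⟩
    parity (toℕ (f v) ℕ.+ 3 ℕ.* B)                 ≡⟨ +-homo-+ (toℕ (f v)) (3 ℕ.* B) ⟩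
    parity (toℕ (f v)) + parity (3 ℕ.* B)          ≡⟨ cong (parity (toℕ (f v)) +_) (*-homo-* 3 B) ⟩
    parity (toℕ (f v)) + parity B                  ∎
    where
    open ≡-Reasoning
    B : ℕ
    B = degSum G bridgeValue v

  bridgeValue-bridge : Bridge G e → bridgeValue e ≡ nonzero (oddJoin e)
  bridgeValue-bridge {e} b = cong (if_then nonzero (oddJoin e) else zero) (dec-true (bridge? e) b)

  bridgeValue-nonbridge : ¬ Bridge G e → bridgeValue e ≡ zero
  bridgeValue-nonbridge {e} nb = cong (if_then nonzero (oddJoin e) else zero) (dec-false (bridge? e) nb)

  bridgeValue-cut : ∀ r e → parity (toℕ (bridgeValue e)) * cut G (component r) e ≡ oddJoin e * cut G (component r) e
  bridgeValue-cut r e with bridge? e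
  ... | yes b = cong (_* cut G (component r) e)
                     (trans (cong (parity ∘ toℕ) (bridgeValue-bridge b)) (parity-nonzero (oddJoin e)))
  ... | no nb = begin
    parity (toℕ (bridgeValue e)) * cut G (component r) e ≡⟨ cong₂ (λ z k → parity (toℕ z) * k) (bridgeValue-nonbridge nb) (cut-nonbridge r nb) ⟩
    0ℙ                                                   ≡⟨ sym (*-zeroʳ (oddJoin e)) ⟩
    oddJoin e * 0ℙ                                       ≡⟨ cong (oddJoin e *_) (sym (cut-nonbridge r nb)) ⟩
    oddJoin e * cut G (component r) e                    ∎
    where open ≡-Reasoning

  f′-even : ∀ r → 2 ∣ sumFin G n (λ v → if component r v then toℕ (f′ v) else 0)
  f′-even r = parity≡0ℙ⇒∣ (begin
    parity (sumFin G n (λ v → if C v then toℕ (f′ v) else 0))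
      ≡⟨ parity-sumFin G n _ ⟩
    ∑[ v < n ] parity (if C v then toℕ (f′ v) else 0)
      ≡⟨ sum-cong-≗ {n} (λ v → trans (parity-if (C v) _) (trans (cong (ℙ[ C v ] *_) (parity-f′ v))
                                      (*-distribˡ-+ ℙ[ C v ] (parity (toℕ (f v))) _))) ⟩
    ∑[ v < n ] (ℙ[ C v ] * parity (toℕ (f v)) + ℙ[ C v ] * parity (degSum G bridgeValue v))
      ≡⟨ ∑-distrib-+ (λ v → ℙ[ C v ] * parity (toℕ (f v))) _ ⟩
    S + ∑[ v < n ] (ℙ[ C v ] * parity (degSum G bridgeValue v))
      ≡⟨ cong (S +_) (∑-parity-degSum G C bridgeValue) ⟩
    S + ∑[ e < m ] (parity (toℕ (bridgeValue e)) * cut G C e)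
      ≡⟨ cong (S +_) (sum-cong-≗ {m} (bridgeValue-cut r)) ⟩
    S + ∑[ e < m ] (oddJoin e * cut G C e)
      ≡⟨ cong (S +_) (∑-tJoin-cut G connected root _ f-even C) ⟩
    S + S
      ≡⟨ p+p≡0ℙ S ⟩
    0ℙ
      ∎)
    where
    open ≡-Reasoning
    C : Fin n → Bool
    C = component r
    S : Parity
    S = ∑[ v < n ] (ℙ[ C v ] * parity (toℕ (f v)))

  private
    factor : ∀ r → Σ (Fin m → Fin 4) λ x →
      (∀ e → ¬ CompEdges G (component r) e → x e ≡ zero) ×
      (∀ v → component r v ≡ true → degSum G x v % 4 ≡ toℕ (f′ v)) ×
      ConnectedOn G (component r) (λ e → CompEdges G (component r) e × x e ≢ zero)
    factor r = components-allRound (component r) (component-isComponent r) f′ (f′-even r)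

  X : Fin n → Fin m → Fin 4
  X r = proj₁ (factor r)

  X-outside : ∀ r e → ¬ CompEdges G (component r) e → X r e ≡ zero
  X-outside r = proj₁ (proj₂ (factor r))

  X-degree : ∀ r v → component r v ≡ true → degSum G (X r) v % 4 ≡ toℕ (f′ v)
  X-degree r = proj₁ (proj₂ (proj₂ (factor r)))

  X-connected : ∀ r → ConnectedOn G (component r) (λ e → CompEdges G (component r) e × X r e ≢ zero)
  X-connected r = proj₂ (proj₂ (proj₂ (factor r)))

  x : Fin m → Fin 4
  x e = if does (bridge? e) then nonzero (oddJoin e) else X (representative (src e)) e

  x-bridge : Bridge G e → x e ≡ nonzero (oddJoin e)
  x-bridge {e} b = cong (if_then nonzero (oddJoin e) else X (representative (src e)) e) (dec-true (bridge? e) b)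

  x-nonbridge : ¬ Bridge G e → x e ≡ X (representative (src e)) e
  x-nonbridge {e} nb = cong (if_then nonzero (oddJoin e) else X (representative (src e)) e) (dec-false (bridge? e) nb)

  representative-incident : ¬ Bridge G e → incident G e c ≡ true → representative (src e) ≡ representative c
  representative-incident {e} {c} nb inc with src e ≟ c | tgt e ≟ c
  ... | yes refl | _ = refl
  ... | no _ | yes refl = representative-cong (step e nb (inj₁ (refl , refl)) here)

  x-split : ∀ c e → incident G e c ≡ true → toℕ (x e) ≡ toℕ (X (representative c) e) ℕ.+ toℕ (bridgeValue e)
  x-split c e inc = by-cases (bridge? e)
    where
    open ≡-Reasoning
    by-cases : Dec (Bridge G e) → toℕ (x e) ≡ toℕ (X (representative c) e) ℕ.+ toℕ (bridgeValue e)
    by-cases (yes b) = begin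
      toℕ (x e)                                             ≡⟨ cong toℕ (x-bridge b) ⟩
      toℕ (nonzero (oddJoin e))                             ≡⟨ cong₂ (λ z w → toℕ z ℕ.+ toℕ w) (sym X≡0) (sym (bridgeValue-bridge b)) ⟩
      toℕ (X (representative c) e) ℕ.+ toℕ (bridgeValue e)   ∎
      where
      X≡0 : X (representative c) e ≡ zero
      X≡0 = X-outside (representative c) e (λ (nb , _) → nb b)
    by-cases (no nb) = begin
      toℕ (x e)                                             ≡⟨ cong toℕ (trans (x-nonbridge nb) (cong (λ ρ → X ρ e) (representative-incident nb inc))) ⟩
      toℕ (X (representative c) e)                          ≡⟨ sym (ℕₚ.+-identityʳ _) ⟩
      toℕ (X (representative c) e) ℕ.+ 0                    ≡⟨ cong (λ z → toℕ (X (representative c) e) ℕ.+ toℕ z) (sym (bridgeValue-nonbridge nb)) ⟩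
      toℕ (X (representative c) e) ℕ.+ toℕ (bridgeValue e)   ∎

  x-degree : ∀ c → degSum G x c % 4 ≡ toℕ (f c)
  x-degree c = begin
    degSum G x c % 4
      ≡⟨ cong (_% 4) (degSum-split G x (X ρ) bridgeValue c (x-split c)) ⟩
    (degSum G (X ρ) c ℕ.+ B) % 4
      ≡⟨ %4-subtract (degSum G (X ρ) c) (toℕ (f c)) B (trans (X-degree ρ c c∈ρ) (toℕ-fromℕ< (m%n<n (toℕ (f c) ℕ.+ 3 ℕ.* B) 4))) ⟩
    toℕ (f c) % 4
      ≡⟨ m<n⇒m%n≡m (toℕ<n (f c)) ⟩
    toℕ (f c)
      ∎
    where
    open ≡-Reasoning
    ρ : Fin n
    ρ = representative c
    B : ℕ
    B = degSum G bridgeValue c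
    c∈ρ : component ρ c ≡ true
    c∈ρ = ~⇒component (Reach-sym G (~-representative c))

  x-on-component : ∀ a → CompEdges G (component (representative a)) e → x e ≡ X (representative a) e
  x-on-component {e} a (nb , src∈ , _) = trans (x-nonbridge nb) (cong (λ ρ → X ρ e) same-representative)
    where
    same-representative : representative (src e) ≡ representative a
    same-representative = trans (sym (representative-cong (component⇒~ src∈)))
                                (representative-cong (Reach-sym G (~-representative a)))

  Support : Fin m → Set
  Support e = ⊤ × x e ≢ zero

  support-edge : ∀ {e} → Joins G e a b → Reach G Support a b
  support-edge {a} {b} {e} j = by-cases (bridge? e)
    where
    by-cases : Dec (Bridge G e) → Reach G Support a b
    by-cases (yes br) = step e (tt , λ x≡0 → nonzero≢zero (oddJoin e) (trans (sym (x-bridge br)) x≡0)) j here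
    by-cases (no nb) = Reach-map G (λ (ce , X≢0) → tt , λ x≡0 → X≢0 (trans (sym (x-on-component a ce)) x≡0))
                         (X-connected (representative a) a b a∈ (~⇒component (~-step nb j a~)))
      where
      a~ : representative a ~ a
      a~ = Reach-sym G (~-representative a)
      a∈ : component (representative a) a ≡ true
      a∈ = ~⇒component a~

  x-connected : ConnectedOn G (λ _ → true) Support
  x-connected u v _ _ = Reach-refine G (λ _ → support-edge) (connected u v refl refl)

inhabited? : ∀ k → Dec (Fin k)
inhabited? ℕ.zero = no λ ()
inhabited? (ℕ.suc k) = yes zero

allRound-vertexless : ∀ G → ¬ Fin (Graph.n G) → AllRound G
allRound-vertexless G ¬v f _ = (λ _ → zero) , (λ _ _ → refl) , (λ v → contradiction v ¬v) , (λ u → contradiction u ¬v)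

theorem5p1 : (G : Graph) → Connected G →
    (∀ v → ¬ IsolatedInG-B G v) →
    (∀ C → IsComponentOfG-B G C → AllRoundOn G C (CompEdges G C)) →
    AllRound G
theorem5p1 G connected _ components-allRound f f-even with inhabited? (Graph.n G)
... | no ¬v = allRound-vertexless G ¬v f f-even
... | yes root = x , (λ _ ¬⊤ → contradiction tt ¬⊤) , (λ v _ → x-degree v) , x-connected
  where
  open Gluing G connected components-allRound f
    (trans (sym (parity-sumFin G _ (toℕ ∘ f))) (∣⇒parity≡0ℙ f-even)) root
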